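{- Let $z\in I_n$ be vexillary and $\lambda=\lambda^{\mathsf{O}}(z)$. Then (a) $|S(z)|=|\operatorname{Ess}(D^{\mathsf{O}}(z))|$, and (b) $S(z)\supseteq\{i\in[\ell(\lambda)-1]:\lambda_i>\lambda_{i+1}+1\}\cup\{\ell(\lambda)\}$.
   Context: $I_n$: involutions in $S_n$, identified with permutation matrices (1 in $(i,z(i))$); $z_{[p][q]}$ is the upper-left $p\times q$ submatrix. Vexillary means $2143$-avoiding. $D^{\mathsf{O}}(z)=\{(i,z(j)):(i,j)\in[n]^2,\ z(i)>z(j)\le i<j\}$; $\operatorname{Ess}(D)=\{(i,j)\in D:(i,j+1)\notin D,(i+1,j)\notin D\}$; $S(z)=\{q-\operatorname{rank}(z_{[p][q]}):(p,q)\in\operatorname{Ess}(D^{\mathsf{O}}(z))\}$. The orthogonal code of $z$ is $(c_1,\dots,c_n)$ with $c_i$ the number of elements of $D^{\mathsf{O}}(z)$ in row $i$, and $\lambda^{\mathsf{O}}(z)$ is the transpose of the partition obtained by sorting the code; $\ell(\lambda)$ is its number of nonzero parts. -}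

module Defs where

open import Data.Nat as ℕ using (ℕ; zero; suc; _∸_)
import Data.Nat.Properties as ℕP
open import Data.Fin using (Fin; toℕ; _<_; _≤_)
open import Data.Fin.Properties using (any?; _<?_; _≤?_)
open import Data.List using (List; length; filter; allFin; cartesianProduct; map; upTo; deduplicate)
open import Data.Product using (Σ; Σ-syntax; ∃; _×_; _,_)
open import Data.Product.Properties using ()
open import Relation.Nullary using (Dec; ¬_; ¬?)
open import Relation.Nullary.Decidable using (_×-dec_)
open import Relation.Binary.PropositionalEquality using (_≡_)

-- Conventions: [n] = {1..n} is represented by Fin n (0-indexed: Fin-value k ↔ k+1).
-- A permutation/involution z is a function Fin n → Fin n; z ∈ I_n iff z (z i) ≡ i for all i.

IsInvolution : ∀ {n} → (Fin n → Fin n) → Set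
IsInvolution z = ∀ i → z (z i) ≡ i

Contains2143 : ∀ {n} → (Fin n → Fin n) → Set
Contains2143 {n} z = Σ[ a ∈ Fin n ] Σ[ b ∈ Fin n ] Σ[ c ∈ Fin n ] Σ[ d ∈ Fin n ]
  (a < b × b < c × c < d × z b < z a × z a < z d × z d < z c)

Vexillary : ∀ {n} → (Fin n → Fin n) → Set
Vexillary z = ¬ Contains2143 z

-- (a , b) ∈ D^O(z), coordinates as 0-indexed naturals (so that out-of-range
-- coordinates are simply not in D):
-- D^O(z) = {(i, z j) : z i > z j ≤ i < j}.
InD : ∀ {n} → (Fin n → Fin n) → ℕ → ℕ → Set
InD {n} z a b = Σ[ i ∈ Fin n ] Σ[ j ∈ Fin n ]
  (toℕ i ≡ a × toℕ (z j) ≡ b × z j < z i × toℕ (z j) ℕ.≤ toℕ i × i < j)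

InD? : ∀ {n} (z : Fin n → Fin n) a b → Dec (InD z a b)
InD? z a b = any? λ i → any? λ j →
  (toℕ i ℕP.≟ a) ×-dec ((toℕ (z j) ℕP.≟ b) ×-dec ((z j <? z i) ×-dec
    ((toℕ (z j) ℕP.≤? toℕ i) ×-dec (i <? j))))

IsEss : ∀ {n} → (Fin n → Fin n) → Fin n × Fin n → Set
IsEss z (p , q) = InD z (toℕ p) (toℕ q) × ¬ InD z (toℕ p) (suc (toℕ q)) × ¬ InD z (suc (toℕ p)) (toℕ q)

IsEss? : ∀ {n} (z : Fin n → Fin n) pq → Dec (IsEss z pq)
IsEss? z (p , q) = InD? z (toℕ p) (toℕ q) ×-dec (¬? (InD? z (toℕ p) (suc (toℕ q))) ×-dec ¬? (InD? z (suc (toℕ p)) (toℕ q)))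

Ess : ∀ {n} → (Fin n → Fin n) → List (Fin n × Fin n)
Ess {n} z = filter (IsEss? z) (cartesianProduct (allFin n) (allFin n))

-- rank of the upper-left (p+1)×(q+1) submatrix of the permutation matrix of z
-- (cells (i, z i)): #{ i ≤ p : z i ≤ q }.
rank : ∀ {n} → (Fin n → Fin n) → Fin n → Fin n → ℕ
rank {n} z p q = length (filter (λ i → (i ≤? p) ×-dec (z i ≤? q)) (allFin n))

-- The values q - rank(z_[p][q]) for (p,q) ∈ Ess, with 1-indexed q = toℕ q + 1.
SList : ∀ {n} → (Fin n → Fin n) → List ℕ
SList z = map (λ { (p , q) → suc (toℕ q) ∸ rank z p q }) (Ess z)

SSet : ∀ {n} → (Fin n → Fin n) → List ℕ
SSet z = deduplicate ℕP._≟_ (SList z)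

code : ∀ {n} → (Fin n → Fin n) → Fin n → ℕ
code {n} z i = length (filter (λ b → InD? z (toℕ i) (toℕ b)) (allFin n))

-- λ^O(z)_k (k ≥ 1) = k-th part of the transpose of the sorted code
--                  = #{ i : c_i ≥ k }  (the conjugate partition).
lamO : ∀ {n} → (Fin n → Fin n) → ℕ → ℕ
lamO {n} z k = length (filter (λ i → k ℕP.≤? code z i) (allFin n))

-- ℓ(λ) = number of nonzero parts λ_k, k ≥ 1 (all parts with k > n vanish since c_i ≤ n).
lenO : ∀ {n} → (Fin n → Fin n) → ℕ
lenO {n} z = length (filter (λ k → 1 ℕP.≤? lamO z k) (map suc (upTo n)))

module Submission where

open import Defs
open import Data.Nat using (ℕ; _+_; _<_; _≤_; suc)
open import Data.Fin using (Fin)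
open import Data.List using (length)
open import Data.List.Membership.Propositional using (_∈_)
open import Data.Product using (_×_)
open import Relation.Binary.PropositionalEquality using (_≡_)

open import Level using (Level)
open import Data.Nat using (zero; _∸_; s≤s; s≤s⁻¹; _≤?_; _<?_; _≤′_; ≤′-refl; ≤′-step)
import Data.Nat.Properties as ℕ
open import Data.Fin as Fin using (toℕ; fromℕ<)
import Data.Fin.Properties as Finₚ
open import Data.List
  using (List; []; _∷_; _++_; filter; map; tabulate; applyUpTo; upTo; allFin; cartesianProduct; deduplicate)
open import Data.List.Properties
  using ( length-map; length-filter; length-tabulate; length-upTo; map-tabulate; upTo-∷ʳ; ++-identityʳ
        ; filter-≐; filter-some; filter-all; filter-reject; filter-++ )
import Data.List.Relation.Unary.All as All
open import Data.List.Relation.Unary.All using ([]; _∷_)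
open import Data.List.Relation.Unary.All.Properties using (all-filter; applyUpTo⁺₁) renaming (map⁺ to All-map⁺)
open import Data.List.Relation.Unary.Any using (here; there)
open import Data.List.Relation.Unary.AllPairs using ([]; _∷_)
open import Data.List.Relation.Unary.Unique.Propositional using (Unique)
import Data.List.Relation.Unary.Unique.Propositional.Properties as Uniqueₚ
open import Data.List.Membership.Propositional using (lose)
open import Data.List.Membership.Propositional.Properties
  using (∈-allFin; ∈-map⁺; ∈-filter⁺; ∈-filter⁻; ∈-cartesianProduct⁺; ∈-deduplicate⁺)
open import Data.List.Membership.Propositional.Properties.WithK using (unique∧set⇒bag)
open import Data.List.Relation.Binary.BagAndSetEquality using (∼bag⇒↭)
open import Data.List.Relation.Binary.Permutation.Propositional using (_↭_)
open import Data.List.Relation.Binary.Permutation.Propositional.Properties using (↭-length; filter-↭)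
open import Data.List.Extrema.Nat using (argmax; argmax-all; f[xs]≤f[argmax])
open import Data.Product using (∃; ∃₂; ∃-syntax; _,_; proj₁; proj₂)
open import Data.Sum using (inj₁; inj₂)
open import Function using (id; _∘_; _⇔_; mk⇔; Equivalence)
open import Relation.Nullary using (Dec; yes; no; ¬_; ¬?; _×-dec_; _→-dec_; contradiction)
open import Relation.Unary using (Pred; Decidable; _⊆_; _≐_)
open import Relation.Unary.Properties using (_∩?_; ∁?)
open import Relation.Binary using (DecidableEquality; tri<; tri≈; tri>)
open import Relation.Binary.PropositionalEquality
  using (_≢_; refl; sym; trans; cong; cong₂; subst; subst₂; module ≡-Reasoning)

-- Write D for D^O(z) and corank p q = (q + 1) − rank z_[p][q], the number of columns c ≤ q
-- whose 1 lies strictly below row p.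
--
-- (a) If (p , q) and (p₂ , q₂) are essential and p < p₂, then q₂ ≤ q. Otherwise, as the cells
-- south and east of (p , q) are not in D, the 1 in row p + 1 lies weakly west of column q and
-- the 1 in column q + 1 weakly north of row p; these two 1s and the 1s in row p₂ and column q₂
-- form a 2143. Along this south-west chain corank strictly decreases, so corank is injective
-- on Ess(D) and |S(z)| = |Ess(D)|.
--
-- (b) λ_k counts the rows of code ≥ k, so λ_i > λ_{i+1} + 1 yields two rows r₁ < r₂ of code i,
-- and ℓ(λ) is the largest code. Let (r , c) be the last cell of row r₂, resp. of a row r of
-- largest code; then code r = corank r c. Sliding (r , c) down column c as far as D reaches
-- without changing corank ends in an essential cell, provided nothing of D lies east of that
-- run: for two equal codes vexillarity keeps (r₂ , r₂) out of D, so c < r₂ and the 1 in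
-- column c + 1 lies above row r₂; for the largest code a cell east of the run would sit in a
-- row of even larger code.

private
  variable
    a ℓ ℓ′ : Level
    A B : Set a

count : {P : Pred A ℓ} → Decidable P → List A → ℕ
count P? xs = length (filter P? xs)

module _ {P : Pred A ℓ} (P? : Decidable P) where

  count-map : (f : B → A) (xs : List B) → count P? (map f xs) ≡ count (P? ∘ f) xs
  count-map f []       = refl
  count-map f (x ∷ xs) with P? (f x)
  ... | yes _ = cong suc (count-map f xs)
  ... | no _  = count-map f xs

  count-witness : (xs : List A) → 0 < count P? xs → ∃ P
  count-witness xs _ with filter P? xs | all-filter P? xs
  ... | x ∷ _ | px ∷ _ = x , px

  count-distinct-witnesses : {xs : List A} → Unique xs → 1 < count P? xs → ∃₂ λ x y → x ≢ y × P x × P y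
  count-distinct-witnesses {xs} u 1<count with filter P? xs | all-filter P? xs | Uniqueₚ.filter⁺ P? u
  count-distinct-witnesses u (s≤s ()) | _ ∷ [] | _ | _
  ... | x ∷ y ∷ _ | px ∷ py ∷ _ | (x≢y ∷ _) ∷ _ = x , y , x≢y , px , py

module _ {P : Pred A ℓ} {Q : Pred A ℓ′} (P? : Decidable P) (Q? : Decidable Q) where

  count-≐ : P ≐ Q → (xs : List A) → count P? xs ≡ count Q? xs
  count-≐ P≐Q xs = cong length (filter-≐ P? Q? P≐Q xs)

  count-⊆-split : P ⊆ Q → (xs : List A) → count Q? xs ≡ count P? xs + count (Q? ∩? ∁? P?) xs
  count-⊆-split P⊆Q []       = refl
  count-⊆-split P⊆Q (x ∷ xs) with P? x | Q? x
  ... | yes _  | yes _  = cong suc (count-⊆-split P⊆Q xs)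
  ... | yes px | no ¬qx = contradiction (P⊆Q px) ¬qx
  ... | no _   | yes _  = trans (cong suc (count-⊆-split P⊆Q xs)) (sym (ℕ.+-suc _ _))
  ... | no _   | no _   = count-⊆-split P⊆Q xs

  count-mono-≤ : P ⊆ Q → (xs : List A) → count P? xs ≤ count Q? xs
  count-mono-≤ P⊆Q xs = subst (count P? xs ≤_) (sym (count-⊆-split P⊆Q xs)) (ℕ.m≤m+n _ _)

  count-mono-< : P ⊆ Q → {x : A} {xs : List A} → x ∈ xs → Q x → ¬ P x → count P? xs < count Q? xs
  count-mono-< P⊆Q {xs = xs} x∈xs qx ¬px = subst (count P? xs <_) (sym (count-⊆-split P⊆Q xs))
    (ℕ.m<m+n _ (filter-some (Q? ∩? ∁? P?) (lose x∈xs (qx , ¬px))))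

filter-<-upTo : {m n : ℕ} → m ≤′ n → filter (_<? m) (upTo n) ≡ upTo m
filter-<-upTo {m} ≤′-refl                = filter-all (_<? m) (applyUpTo⁺₁ id m id)
filter-<-upTo {m} (≤′-step {n} m≤′n) = begin
  filter (_<? m) (upTo (suc n))                       ≡⟨ cong (filter (_<? m)) (upTo-∷ʳ n) ⟨
  filter (_<? m) (upTo n ++ n ∷ [])                   ≡⟨ filter-++ (_<? m) (upTo n) (n ∷ []) ⟩
  filter (_<? m) (upTo n) ++ filter (_<? m) (n ∷ [])  ≡⟨ cong (filter (_<? m) (upTo n) ++_) n∉ ⟩
  filter (_<? m) (upTo n) ++ []                       ≡⟨ ++-identityʳ _ ⟩
  filter (_<? m) (upTo n)                             ≡⟨ filter-<-upTo m≤′n ⟩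
  upTo m                                              ∎
  where
  open ≡-Reasoning
  n∉ = filter-reject (_<? m) (ℕ.≤⇒≯ (ℕ.≤′⇒≤ m≤′n))

count-<-upTo : {m n : ℕ} → m ≤ n → count (_<? m) (upTo n) ≡ m
count-<-upTo {m} m≤n = trans (cong length (filter-<-upTo (ℕ.≤⇒≤′ m≤n))) (length-upTo m)

tabulate-∘toℕ : (f : ℕ → A) (n : ℕ) → tabulate {n = n} (f ∘ toℕ) ≡ applyUpTo f n
tabulate-∘toℕ f zero    = refl
tabulate-∘toℕ f (suc n) = cong (f 0 ∷_) (tabulate-∘toℕ (f ∘ suc) n)

count-≤-allFin : {n : ℕ} (q : Fin n) → count (Finₚ._≤? q) (allFin n) ≡ suc (toℕ q)
count-≤-allFin {n} q = begin
  count (Finₚ._≤? q) (allFin n)                  ≡⟨ count-≐ _ (<1+q? ∘ toℕ) (s≤s , s≤s⁻¹) (allFin n) ⟩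
  count (<1+q? ∘ toℕ) (allFin n)                   ≡⟨ count-map <1+q? toℕ (allFin n) ⟨
  count <1+q? (map toℕ (allFin n))                 ≡⟨ cong (count <1+q?) map-toℕ-allFin ⟩
  count <1+q? (upTo n)                             ≡⟨ count-<-upTo (Finₚ.toℕ<n q) ⟩
  suc (toℕ q)                                    ∎
  where
  open ≡-Reasoning
  <1+q? = _<? suc (toℕ q)
  map-toℕ-allFin = trans (map-tabulate id toℕ) (tabulate-∘toℕ id n)

greatest : {n : ℕ} {P : Pred (Fin n) ℓ} → Decidable P → ∃ P → ∃[ y ] (P y × (∀ {w} → P w → w Fin.≤ y))
greatest {n = n} {P = P} P? (x , px) = y , argmax-all toℕ px (all-filter P? (allFin n)) , y-greatest
  where
  y = argmax toℕ x (filter P? (allFin n))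
  y-greatest : ∀ {w} → P w → w Fin.≤ y
  y-greatest pw = All.lookup (f[xs]≤f[argmax] {f = toℕ} x (filter P? (allFin n))) (∈-filter⁺ P? (∈-allFin _) pw)

maximiser : {n : ℕ} (f : Fin n → ℕ) → Fin n → ∃[ r ] (∀ w → f w ≤ f r)
maximiser {n} f x = argmax f x (allFin n) , λ w → All.lookup (f[xs]≤f[argmax] x (allFin n)) (∈-allFin w)

successor : {n : ℕ} {x y : Fin n} → x Fin.< y → ∃[ s ] toℕ s ≡ suc (toℕ x)
successor {y = y} x<y = fromℕ< (ℕ.≤-<-trans x<y (Finₚ.toℕ<n y)) , Finₚ.toℕ-fromℕ< _

deduplicate-unique : (_≟ᴬ_ : DecidableEquality A) {xs : List A} → Unique xs → deduplicate _≟ᴬ_ xs ≡ xs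
deduplicate-unique _≟ᴬ_ []                 = refl
deduplicate-unique _≟ᴬ_ {x ∷ xs} (x∉xs ∷ u) =
  cong (x ∷_) (trans (cong (filter _) (deduplicate-unique _≟ᴬ_ u)) (filter-all (λ y → ¬? (x ≟ᴬ y)) x∉xs))

Unique-map⁺ : (f : A → B) {xs : List A} → Unique xs →
              (∀ {x y} → x ∈ xs → y ∈ xs → f x ≡ f y → x ≡ y) → Unique (map f xs)
Unique-map⁺ f []         _   = []
Unique-map⁺ f (x∉xs ∷ u) inj =
  All-map⁺ (All.tabulate (λ y∈xs fx≡fy → All.lookup x∉xs y∈xs (inj (here refl) (there y∈xs) fx≡fy)))
  ∷ Unique-map⁺ f u (λ x∈xs y∈xs → inj (there x∈xs) (there y∈xs))

module _ {n : ℕ} (z : Fin n → Fin n) where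

  code≤n : (r : Fin n) → code z r ≤ n
  code≤n r = ℕ.≤-trans (length-filter _ (allFin n)) (ℕ.≤-reflexive (length-tabulate id))

  lenO≡maximal-code : {r : Fin n} → (∀ w → code z w ≤ code z r) → lenO z ≡ code z r
  lenO≡maximal-code {r} r-max = begin
    lenO z                                 ≡⟨ count-map occupied? suc (upTo n) ⟩
    count (occupied? ∘ suc) (upTo n)       ≡⟨ count-≐ (occupied? ∘ suc) (_<? code z r) (occupied⇒< , <⇒occupied) (upTo n) ⟩
    count (_<? code z r) (upTo n)          ≡⟨ count-<-upTo (code≤n r) ⟩
    code z r                               ∎
    where
    open ≡-Reasoning
    occupied? = λ k → 1 ≤? lamO z k
    occupied⇒< : {k : ℕ} → 1 ≤ lamO z (suc k) → k < code z r
    occupied⇒< {k} 0<lamO =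
      let w , k<code = count-witness (λ w → suc k ≤? code z w) (allFin n) 0<lamO
      in ℕ.≤-trans k<code (r-max w)
    <⇒occupied : {k : ℕ} → k < code z r → 1 ≤ lamO z (suc k)
    <⇒occupied {k} k<code = filter-some (λ w → suc k ≤? code z w) (lose (∈-allFin r) k<code)

  two-rows-of-code : (k : ℕ) → lamO z (suc k) + 1 < lamO z k →
                     ∃₂ λ r₁ r₂ → r₁ ≢ r₂ × code z r₁ ≡ k × code z r₂ ≡ k
  two-rows-of-code k gap with count-distinct-witnesses exactly? (Uniqueₚ.allFin⁺ n) 1<exactly
    where
    exactly? = (λ r → k ≤? code z r) ∩? ∁? (λ r → suc k ≤? code z r)
    split = count-⊆-split (λ r → suc k ≤? code z r) (λ r → k ≤? code z r) (ℕ.≤-trans (ℕ.n≤1+n k)) (allFin n)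
    1<exactly : 1 < count exactly? (allFin n)
    1<exactly = ℕ.+-cancelˡ-< (lamO z (suc k)) 1 _ (subst (lamO z (suc k) + 1 <_) split gap)
  ... | r₁ , r₂ , r₁≢r₂ , (k≤₁ , k≮₁) , (k≤₂ , k≮₂) =
    r₁ , r₂ , r₁≢r₂ , ℕ.≤-antisym (ℕ.≮⇒≥ k≮₁) k≤₁ , ℕ.≤-antisym (ℕ.≮⇒≥ k≮₂) k≤₂

module Involution {n : ℕ} (z : Fin n → Fin n) (inv : IsInvolution z) where

  private
    variable
      c i j p p₂ q q₂ r r₁ r₂ w x y : Fin n

  z-injective : z x ≡ z y → x ≡ y
  z-injective {x} {y} zx≡zy = trans (sym (inv x)) (trans (cong z zx≡zy) (inv y))

  z-swap : z x ≡ y → z y ≡ x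
  z-swap {x} refl = inv x

  ≤∧z<⇒< : x Fin.≤ y → z x Fin.< z y → x Fin.< y
  ≤∧z<⇒< x≤y zx<zy = ℕ.≤∧≢⇒< x≤y (λ x≡y → ℕ.<-irrefl (cong (toℕ ∘ z) (Finₚ.toℕ-injective x≡y)) zx<zy)

  map-z-↭-allFin : map z (allFin n) ↭ allFin n
  map-z-↭-allFin = ∼bag⇒↭ (unique∧set⇒bag (Uniqueₚ.map⁺ z-injective (Uniqueₚ.allFin⁺ n)) (Uniqueₚ.allFin⁺ n)
    (λ {x} → mk⇔ (λ _ → ∈-allFin x) (λ _ → subst (_∈ map z (allFin n)) (inv x) (∈-map⁺ z (∈-allFin (z x))))))

  count-∘z : {P : Pred (Fin n) ℓ} (P? : Decidable P) → count P? (allFin n) ≡ count (P? ∘ z) (allFin n)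
  count-∘z P? = begin
    count P? (allFin n)          ≡⟨ ↭-length (filter-↭ P? map-z-↭-allFin) ⟨
    count P? (map z (allFin n))  ≡⟨ count-map P? z (allFin n) ⟩
    count (P? ∘ z) (allFin n)    ∎
    where open ≡-Reasoning

  -- The cell (i , z j) of D^O(z), written (p , c) with c = z j: the condition i < j becomes p < z c.
  D : Fin n → Fin n → Set
  D p c = c Fin.< z p × c Fin.≤ p × p Fin.< z c

  D? : ∀ p c → Dec (D p c)
  D? p c = (c Finₚ.<? z p) ×-dec (c Finₚ.≤? p) ×-dec (p Finₚ.<? z c)

  InD⇒D : ∀ {a b} → InD z a b → ∃₂ λ i c → toℕ i ≡ a × toℕ c ≡ b × D i c
  InD⇒D (i , j , refl , refl , zj<zi , zj≤i , i<j) =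
    i , z j , refl , refl , zj<zi , zj≤i , subst (i Fin.<_) (sym (inv j)) i<j

  D⇒InD : D i c → InD z (toℕ i) (toℕ c)
  D⇒InD {i} {c} (c<zi , c≤i , i<zc) =
    i , z c , refl , cong toℕ (inv c) ,
    subst (Fin._< z i) (sym (inv c)) c<zi , subst (Fin._≤ i) (sym (inv c)) c≤i , i<zc

  InD⇔D : InD z (toℕ i) (toℕ c) ⇔ D i c
  InD⇔D = mk⇔ to D⇒InD
    where
    to : InD z (toℕ i) (toℕ c) → D i c
    to ind with InD⇒D ind
    ... | _ , _ , i′≡i , c′≡c , d with Finₚ.toℕ-injective i′≡i | Finₚ.toℕ-injective c′≡c
    ... | refl | refl = d

  record Essential (p q : Fin n) : Set where
    field
      cell  : D p q
      south : toℕ i ≡ suc (toℕ p) → ¬ D i q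
      east  : toℕ j ≡ suc (toℕ q) → ¬ D p j

  IsEss⇔Essential : IsEss z (p , q) ⇔ Essential p q
  IsEss⇔Essential {p} {q} = mk⇔ to from
    where
    to : IsEss z (p , q) → Essential p q
    to (ind , ¬east , ¬south) = record
      { cell  = Equivalence.to InD⇔D ind
      ; south = λ i≡1+p d → ¬south (subst (λ a → InD z a (toℕ q)) i≡1+p (D⇒InD d))
      ; east  = λ j≡1+q d → ¬east (subst (InD z (toℕ p)) j≡1+q (D⇒InD d))
      }
    from : Essential p q → IsEss z (p , q)
    from e = D⇒InD cell , ¬east , ¬south
      where
      open Essential e
      ¬east : ¬ InD z (toℕ p) (suc (toℕ q))
      ¬east ind with InD⇒D ind
      ... | _ , _ , p′≡p , j≡1+q , d with Finₚ.toℕ-injective p′≡p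
      ... | refl = east j≡1+q d
      ¬south : ¬ InD z (suc (toℕ p)) (toℕ q)
      ¬south ind with InD⇒D ind
      ... | _ , _ , i≡1+p , q′≡q , d with Finₚ.toℕ-injective q′≡q
      ... | refl = south i≡1+p d

  Below : Fin n → Fin n → Pred (Fin n) _
  Below p q c = c Fin.≤ q × p Fin.< z c

  Below? : ∀ p q → Decidable (Below p q)
  Below? p q c = (c Finₚ.≤? q) ×-dec (p Finₚ.<? z c)

  corank : Fin n → Fin n → ℕ
  corank p q = count (Below? p q) (allFin n)

  rank+corank : rank z p q + corank p q ≡ suc (toℕ q)
  rank+corank {p = p} {q = q} = begin
    rank z p q + corank p q
      ≡⟨ cong₂ _+_ rank≡ (count-≐ (Below? p q) (≤q? ∩? ∁? Above?) below≐ (allFin n)) ⟩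
    count Above? (allFin n) + count (≤q? ∩? ∁? Above?) (allFin n)
      ≡⟨ count-⊆-split Above? ≤q? proj₁ (allFin n) ⟨
    count ≤q? (allFin n)
      ≡⟨ count-≤-allFin q ⟩
    suc (toℕ q)
      ∎
    where
    open ≡-Reasoning
    ≤q? = Finₚ._≤? q
    Above : Pred (Fin n) _
    Above c = c Fin.≤ q × z c Fin.≤ p
    Above? : Decidable Above
    Above? c = (c Finₚ.≤? q) ×-dec (z c Finₚ.≤? p)
    rank≡ : rank z p q ≡ count Above? (allFin n)
    rank≡ = trans (count-∘z _) (count-≐ _ Above?
      ( (λ (zc≤p , zzc≤q) → subst (Fin._≤ q) (inv _) zzc≤q , zc≤p)
      , (λ (c≤q , zc≤p) → zc≤p , subst (Fin._≤ q) (sym (inv _)) c≤q) ) (allFin n))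
    below≐ : Below p q ≐ (λ c → c Fin.≤ q × ¬ Above c)
    below≐ = (λ (c≤q , p<zc) → c≤q , λ (_ , zc≤p) → ℕ.<⇒≱ p<zc zc≤p)
           , (λ (c≤q , ¬above) → c≤q , ℕ.≰⇒> (λ zc≤p → ¬above (c≤q , zc≤p)))

  suc∸rank≡corank : suc (toℕ q) ∸ rank z p q ≡ corank p q
  suc∸rank≡corank {q = q} {p = p} =
    trans (cong (_∸ rank z p q) (sym rank+corank)) (ℕ.m+n∸m≡n (rank z p q) (corank p q))

  corank∈SSet : Essential p q → corank p q ∈ SSet z
  corank∈SSet {p = p} {q = q} e = ∈-deduplicate⁺ ℕ._≟_ (subst (_∈ SList z) suc∸rank≡corank
    (∈-map⁺ _ (∈-filter⁺ (IsEss? z) (∈-cartesianProduct⁺ (∈-allFin p) (∈-allFin q))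
                                   (Equivalence.from IsEss⇔Essential e))))

  corank-<ʳ : p Fin.< z q₂ → q Fin.< q₂ → corank p q < corank p q₂
  corank-<ʳ p<zq₂ q<q₂ = count-mono-< (Below? _ _) (Below? _ _)
    (λ (c≤q , p<zc) → ℕ.≤-trans c≤q (ℕ.<⇒≤ q<q₂) , p<zc)
    (∈-allFin _) (ℕ.≤-refl , p<zq₂) (λ (q₂≤q , _) → ℕ.<⇒≱ q<q₂ q₂≤q)

  corank-<ˡ : p Fin.< i → i Fin.≤ p₂ → z i Fin.≤ q → q₂ Fin.≤ q → corank p₂ q₂ < corank p q
  corank-<ˡ {i = i} p<i i≤p₂ zi≤q q₂≤q = count-mono-< (Below? _ _) (Below? _ _)
    (λ (c≤q₂ , p₂<zc) → ℕ.≤-trans c≤q₂ q₂≤q , ℕ.<-≤-trans p<i (ℕ.≤-trans i≤p₂ (ℕ.<⇒≤ p₂<zc)))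
    (∈-allFin (z i)) (zi≤q , subst (_ Fin.<_) (sym (inv i)) p<i)
    (λ (_ , p₂<zzi) → ℕ.<⇒≱ (subst (_ Fin.<_) (inv i) p₂<zzi) i≤p₂)

  south-exit : D p q → toℕ i ≡ suc (toℕ p) → ¬ D i q → z i Fin.≤ q
  south-exit {p} {q} {i} (_ , q≤p , p<zq) i≡1+p ¬Diq = ℕ.≮⇒≥ q≮zi
    where
    p<i : p Fin.< i
    p<i = ℕ.≤-reflexive (sym i≡1+p)
    q≮zi : ¬ q Fin.< z i
    q≮zi q<zi with i Finₚ.<? z q
    ... | yes i<zq = ¬Diq (q<zi , ℕ.<⇒≤ (ℕ.≤-<-trans q≤p p<i) , i<zq)
    ... | no i≮zq  = ℕ.<-irrefl refl (subst (q Fin.<_) (z-swap zq≡i) q<zi)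
      where
      zq≡i : z q ≡ i
      zq≡i = Finₚ.≤-antisym (ℕ.≮⇒≥ i≮zq) (subst (_≤ toℕ (z q)) (sym i≡1+p) p<zq)

  east-exit : D p q → toℕ j ≡ suc (toℕ q) → j Fin.≤ p → ¬ D p j → z j Fin.≤ p
  east-exit {p} {q} {j} (q<zp , _ , _) j≡1+q j≤p ¬Dpj = ℕ.≮⇒≥ p≮zj
    where
    p≮zj : ¬ p Fin.< z j
    p≮zj p<zj with j Finₚ.<? z p
    ... | yes j<zp = ¬Dpj (j<zp , j≤p , p<zj)
    ... | no j≮zp  = ℕ.<-irrefl refl (subst (p Fin.<_) (z-swap zp≡j) p<zj)
      where
      zp≡j : z p ≡ j
      zp≡j = Finₚ.≤-antisym (ℕ.≮⇒≥ j≮zp) (subst (_≤ toℕ (z p)) (sym j≡1+q) q<zp)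

  essential-east-exit : Essential p q → toℕ j ≡ suc (toℕ q) → z j Fin.≤ p
  essential-east-exit {p} {q} {j} e j≡1+q with j Finₚ.≤? p
  ... | yes j≤p = east-exit cell j≡1+q j≤p (east j≡1+q)
    where open Essential e
  ... | no j≰p  = ℕ.≤-trans (south-exit cell j≡1+p (south j≡1+p)) q≤p
    where
    open Essential e
    q≤p : q Fin.≤ p
    q≤p = proj₁ (proj₂ cell)
    j≡1+p : toℕ j ≡ suc (toℕ p)
    j≡1+p = trans j≡1+q (cong suc (ℕ.≤-antisym q≤p (s≤s⁻¹ (subst (toℕ p <_) j≡1+q (ℕ.≰⇒> j≰p)))))

  code≡count-D : code z r ≡ count (D? r) (allFin n)
  code≡count-D {r} = count-≐ _ (D? r) (Equivalence.to InD⇔D , Equivalence.from InD⇔D) (allFin n)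

  code≡corank : D r c → (∀ {w} → D r w → w Fin.≤ c) → code z r ≡ corank r c
  code≡corank {r} {c} (c<zr , c≤r , _) c-last = trans code≡count-D (count-≐ (D? r) (Below? r c)
    ( (λ d → c-last d , proj₂ (proj₂ d))
    , (λ (w≤c , r<zw) → ℕ.≤-<-trans w≤c c<zr , ℕ.≤-trans w≤c c≤r , r<zw) ) (allFin n))

  corank≤code : D p j → corank p j ≤ code z p
  corank≤code {p} {j} (j<zp , j≤p , _) = subst (corank p j ≤_) (sym code≡count-D)
    (count-mono-≤ (Below? p j) (D? p)
      (λ (w≤j , p<zw) → ℕ.≤-<-trans w≤j j<zp , ℕ.≤-trans w≤j j≤p , p<zw) (allFin n))

  last-cell : 0 < code z r → ∃[ c ] (D r c × (∀ {w} → D r w → w Fin.≤ c))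
  last-cell {r} 0<code = greatest (D? r) (count-witness (D? r) (allFin n) (subst (0 <_) code≡count-D 0<code))

  -- Rows p in Block r c are those below r with no 1 of z in rows (r , p] and columns ≤ c.
  Block : Fin n → Fin n → Pred (Fin n) _
  Block r c p = r Fin.≤ p × (∀ w → Below r c w → Below p c w)

  Block? : ∀ r c → Decidable (Block r c)
  Block? r c p = (r Finₚ.≤? p) ×-dec Finₚ.all? (λ w → Below? r c w →-dec Below? p c w)

  EastClosed : Fin n → Fin n → Set
  EastClosed r c = ∀ {p j} → Block r c p → toℕ j ≡ suc (toℕ c) → ¬ D p j

  block-corank : Block r c p → corank p c ≡ corank r c
  block-corank {r} {c} {p} (r≤p , below⊆) = count-≐ (Below? p c) (Below? r c)
    ((λ (w≤c , p<zw) → w≤c , ℕ.≤-<-trans r≤p p<zw) , below⊆ _) (allFin n)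

  block-cell : D r c → Block r c p → D p c
  block-cell {r} {c} {p} (c<zr , c≤r , r<zc) (r≤p , below⊆) =
    c<zp , ℕ.≤-trans c≤r r≤p , proj₂ (below⊆ c (ℕ.≤-refl , r<zc))
    where
    c<zp : c Fin.< z p
    c<zp with ℕ.m≤n⇒m<n∨m≡n r≤p
    ... | inj₂ r≡p = subst (λ x → c Fin.< z x) (Finₚ.toℕ-injective r≡p) c<zr
    ... | inj₁ r<p = ℕ.≰⇒> λ zp≤c →
      ℕ.<-irrefl (cong toℕ (sym (inv p))) (proj₂ (below⊆ (z p) (zp≤c , subst (r Fin.<_) (sym (inv p)) r<p)))

  block-bottom : ∃[ p ] (Block r c p × (∀ {i} → toℕ i ≡ suc (toℕ p) → ¬ D i c))
  block-bottom {r} {c} with greatest (Block? r c) (r , ℕ.≤-refl , λ _ b → b)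
  ... | p , block , p-last = p , block , south
    where
    south : toℕ i ≡ suc (toℕ p) → ¬ D i c
    south {i} i≡1+p (c<zi , _ , _) = ℕ.<⇒≱ p<i (p-last (ℕ.≤-trans (proj₁ block) (ℕ.<⇒≤ p<i) , below⊆))
      where
      p<i : p Fin.< i
      p<i = ℕ.≤-reflexive (sym i≡1+p)
      below⊆ : ∀ w → Below r c w → Below i c w
      below⊆ w b with proj₂ block w b
      ... | w≤c , p<zw = w≤c , ℕ.≤∧≢⇒< (subst (_≤ toℕ (z w)) (sym i≡1+p) p<zw) λ i≡zw →
        ℕ.<⇒≱ c<zi (subst (Fin._≤ c) (sym (z-swap (sym (Finₚ.toℕ-injective i≡zw)))) w≤c)

  eastClosed⇒corank∈SSet : D r c → EastClosed r c → corank r c ∈ SSet z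
  eastClosed⇒corank∈SSet {r} {c} d east-closed with block-bottom {r} {c}
  ... | p , block , south = subst (_∈ SSet z) (block-corank block)
    (corank∈SSet record { cell = block-cell d block ; south = south ; east = east-closed block })

  maximal-code∈SSet : (∀ w → code z w ≤ code z r) → 0 < code z r → code z r ∈ SSet z
  maximal-code∈SSet {r} r-max 0<code with last-cell 0<code
  ... | c , d , c-last = subst (_∈ SSet z) (sym code≡corank′) (eastClosed⇒corank∈SSet d east-closed)
    where
    code≡corank′ = code≡corank d c-last
    east-closed : EastClosed r c
    east-closed {p} {j} block j≡1+c dpj = ℕ.<-irrefl (block-corank block) (begin-strict
      corank p c  <⟨ corank-<ʳ (proj₂ (proj₂ dpj)) (ℕ.≤-reflexive (sym j≡1+c)) ⟩
      corank p j  ≤⟨ corank≤code dpj ⟩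
      code z p    ≤⟨ r-max p ⟩
      code z r    ≡⟨ code≡corank′ ⟩
      corank r c  ∎)
      where open ℕ.≤-Reasoning

  lenO∈SSet : 0 < lenO z → lenO z ∈ SSet z
  lenO∈SSet 0<lenO =
    let k , 0<lamO = count-witness (λ k → 1 ≤? lamO z k) (map suc (upTo n)) 0<lenO
        r₀ , _     = count-witness (λ r → k ≤? code z r) (allFin n) 0<lamO
        r , r-max  = maximiser (code z) r₀
        lenO≡code  = lenO≡maximal-code z r-max
    in subst (_∈ SSet z) (sym lenO≡code) (maximal-code∈SSet r-max (subst (0 <_) lenO≡code 0<lenO))

  module _ (vex : Vexillary z) where

    essential-antitone : Essential p q → Essential p₂ q₂ → p Fin.< p₂ → q₂ Fin.≤ q
    essential-antitone {p} {q} {p₂} {q₂} e e₂ p<p₂ = ℕ.≮⇒≥ λ q<q₂ →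
      let i , i≡1+p = successor p<p₂
          j , j≡1+q = successor q<q₂
          zi≤q = south-exit (Essential.cell e) i≡1+p (Essential.south e i≡1+p)
          zj≤p = essential-east-exit e j≡1+q
          (q₂<zp₂ , _ , p₂<zq₂) = Essential.cell e₂
          p<i = ℕ.≤-reflexive (sym i≡1+p)
          q<j = ℕ.≤-reflexive (sym j≡1+q)
          i<p₂ = ≤∧z<⇒< (ℕ.≤-trans (ℕ.≤-reflexive i≡1+p) p<p₂) (ℕ.≤-<-trans zi≤q (ℕ.<-trans q<q₂ q₂<zp₂))
          j<q₂ = ≤∧z<⇒< (ℕ.≤-trans (ℕ.≤-reflexive j≡1+q) q<q₂) (ℕ.≤-<-trans zj≤p (ℕ.<-trans p<p₂ p₂<zq₂))
      in vex ( z j , i , p₂ , z q₂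
             , ℕ.≤-<-trans zj≤p p<i , i<p₂ , p₂<zq₂
             , subst (z i Fin.<_) (sym (inv j)) (ℕ.≤-<-trans zi≤q q<j)
             , subst₂ Fin._<_ (sym (inv j)) (sym (inv q₂)) j<q₂
             , subst (Fin._< z p₂) (sym (inv q₂)) q₂<zp₂ )

    essential-corank-< : Essential p q → Essential p₂ q₂ → p Fin.< p₂ → corank p₂ q₂ < corank p q
    essential-corank-< e e₂ p<p₂ =
      let i , i≡1+p = successor p<p₂
      in corank-<ˡ (ℕ.≤-reflexive (sym i≡1+p)) (ℕ.≤-trans (ℕ.≤-reflexive i≡1+p) p<p₂)
           (south-exit (Essential.cell e) i≡1+p (Essential.south e i≡1+p)) (essential-antitone e e₂ p<p₂)

    essential-corank-injective : Essential p q → Essential p₂ q₂ → corank p q ≡ corank p₂ q₂ →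
                                 (p , q) ≡ (p₂ , q₂)
    essential-corank-injective {p} {q} {p₂} {q₂} e e₂ eq with Finₚ.<-cmp p p₂
    ... | tri< p<p₂ _ _ = contradiction (essential-corank-< e e₂ p<p₂) (ℕ.<-irrefl (sym eq))
    ... | tri> _ _ p₂<p = contradiction (essential-corank-< e₂ e p₂<p) (ℕ.<-irrefl eq)
    ... | tri≈ _ refl _ with Finₚ.<-cmp q q₂
    ...   | tri< q<q₂ _ _ =
      contradiction (corank-<ʳ (proj₂ (proj₂ (Essential.cell e₂))) q<q₂) (ℕ.<-irrefl eq)
    ...   | tri> _ _ q₂<q =
      contradiction (corank-<ʳ (proj₂ (proj₂ (Essential.cell e))) q₂<q) (ℕ.<-irrefl (sym eq))
    ...   | tri≈ _ refl _ = refl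

    length-SSet≡length-Ess : length (SSet z) ≡ length (Ess z)
    length-SSet≡length-Ess = trans (cong length (deduplicate-unique ℕ._≟_ SList-unique)) (length-map _ (Ess z))
      where
      essential : (p , q) ∈ Ess z → Essential p q
      essential m = Equivalence.to IsEss⇔Essential
        (proj₂ (∈-filter⁻ (IsEss? z) {xs = cartesianProduct (allFin n) (allFin n)} m))
      SList-unique : Unique (SList z)
      SList-unique = Unique-map⁺ _
        (Uniqueₚ.filter⁺ (IsEss? z) (Uniqueₚ.cartesianProduct⁺ (Uniqueₚ.allFin⁺ n) (Uniqueₚ.allFin⁺ n)))
        (λ m m₂ eq → essential-corank-injective (essential m) (essential m₂)
          (trans (sym suc∸rank≡corank) (trans eq suc∸rank≡corank)))

    row-⊆ : r₁ Fin.< r₂ → D r₂ r₂ → D r₁ c → D r₂ c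
    row-⊆ {r₁} {r₂} {c} r₁<r₂ (_ , _ , r₂<zr₂) (c<zr₁ , c≤r₁ , r₁<zc) with r₂ Finₚ.<? z c
    ... | yes r₂<zc = ℕ.<-trans c<r₂ r₂<zr₂ , ℕ.<⇒≤ c<r₂ , r₂<zc
      where c<r₂ = ℕ.≤-<-trans c≤r₁ r₁<r₂
    ... | no r₂≮zc = contradiction
      ( c , z c , r₂ , z r₂
      , c<zc , zc<r₂ , r₂<zr₂
      , subst (Fin._< z c) (sym (inv c)) c<zc
      , subst (z c Fin.<_) (sym (inv r₂)) zc<r₂
      , subst (Fin._< z r₂) (sym (inv r₂)) r₂<zr₂ ) vex
      where
      c<r₂ = ℕ.≤-<-trans c≤r₁ r₁<r₂
      c<zc = ℕ.≤-<-trans c≤r₁ r₁<zc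
      zc<r₂ = ≤∧z<⇒< (ℕ.≮⇒≥ r₂≮zc) (subst (Fin._< z r₂) (sym (inv c)) (ℕ.<-trans c<r₂ r₂<zr₂))

    diagonal-free : r₁ Fin.< r₂ → code z r₁ ≡ code z r₂ → ¬ D r₂ r₂
    diagonal-free {r₁} {r₂} r₁<r₂ eq d = ℕ.<-irrefl (trans (sym code≡count-D) (trans eq code≡count-D))
      (count-mono-< (D? r₁) (D? r₂) (row-⊆ r₁<r₂ d) (∈-allFin r₂) d (λ (_ , r₂≤r₁ , _) → ℕ.<⇒≱ r₁<r₂ r₂≤r₁))

    ordered-equal-codes∈SSet : r₁ Fin.< r₂ → code z r₁ ≡ code z r₂ → 0 < code z r₂ → code z r₂ ∈ SSet z
    ordered-equal-codes∈SSet {r₁} {r₂} r₁<r₂ eq 0<code with last-cell 0<code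
    ... | c , d , c-last = subst (_∈ SSet z) (sym (code≡corank d c-last)) (eastClosed⇒corank∈SSet d east-closed)
      where
      c<r₂ : c Fin.< r₂
      c<r₂ = ℕ.≤∧≢⇒< (proj₁ (proj₂ d))
        (λ c≡r₂ → diagonal-free r₁<r₂ eq (subst (D r₂) (Finₚ.toℕ-injective c≡r₂) d))
      east-closed : EastClosed r₂ c
      east-closed {p} {j} (r₂≤p , _) j≡1+c (_ , _ , p<zj) = ℕ.<⇒≱ p<zj (ℕ.≤-trans zj≤r₂ r₂≤p)
        where
        c<j : c Fin.< j
        c<j = ℕ.≤-reflexive (sym j≡1+c)
        zj≤r₂ = east-exit d j≡1+c (ℕ.≤-trans (ℕ.≤-reflexive j≡1+c) c<r₂) (λ dr₂j → ℕ.<⇒≱ c<j (c-last dr₂j))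

    equal-codes∈SSet : {k : ℕ} → r₁ ≢ r₂ → code z r₁ ≡ k → code z r₂ ≡ k → 0 < k → k ∈ SSet z
    equal-codes∈SSet {r₁} {r₂} r₁≢r₂ refl eq 0<k with Finₚ.<-cmp r₁ r₂
    ... | tri< r₁<r₂ _ _ =
      subst (_∈ SSet z) eq (ordered-equal-codes∈SSet r₁<r₂ (sym eq) (subst (0 <_) (sym eq) 0<k))
    ... | tri≈ _ r₁≡r₂ _ = contradiction r₁≡r₂ r₁≢r₂
    ... | tri> _ _ r₂<r₁ = ordered-equal-codes∈SSet r₂<r₁ eq 0<k

lemma3p26 : (n : ℕ) (z : Fin n → Fin n) → IsInvolution z → Vexillary z →
    (length (SSet z) ≡ length (Ess z))
    × ((i : ℕ) → 1 ≤ i → suc i ≤ lenO z → lamO z (suc i) + 1 < lamO z i → i ∈ SSet z)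
    × (1 ≤ lenO z → lenO z ∈ SSet z)
lemma3p26 n z inv vex = length-SSet≡length-Ess vex , gap∈SSet , lenO∈SSet
  where
  open Involution z inv
  gap∈SSet : (i : ℕ) → 1 ≤ i → suc i ≤ lenO z → lamO z (suc i) + 1 < lamO z i → i ∈ SSet z
  gap∈SSet i 1≤i _ gap =
    let r₁ , r₂ , r₁≢r₂ , code₁≡i , code₂≡i = two-rows-of-code z i gap
    in equal-codes∈SSet vex r₁≢r₂ code₁≡i code₂≡i 1≤i
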